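{- Let $G$ be a graph and let $g,h$ be tropical polynomials in the variables $V(G)$ such that $f=g\cdot h$ is a partial MWIS-polynomial of $G$. Then the sets $N[\mathrm{Sup}(g)]$ and $\mathrm{Sup}(h)$ are disjoint.
   Context: Tropical polynomials are over the semiring $(\mathbb{R}\cup\{ -\infty\},\max,+)$ with $\max$ as addition and $+$ as multiplication; a tropical polynomial (with all coefficients $0$) is a set of monomials, i.e. finite multisets of variables, and $g\cdot h$ is the set of all products (multiset unions) of a monomial of $g$ with a monomial of $h$. A partial MWIS-polynomial of $G$ is a tropical polynomial in variables $V(G)$ each of whose monomials is of the form $v_1\cdots v_l$ where $\{v_1,\dots,v_l\}$ is an independent set of $G$ (distinct vertices). $\mathrm{Sup}(f)$ denotes the set of variables occurring in monomials of $f$. For $S\subseteq V(G)$, $N[S]$ is $S$ together with all vertices adjacent to a vertex of $S$. -}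

module Defs where

open import Data.Nat using (ℕ; _+_; _≤_; _≥_)
open import Data.Fin using (Fin)
open import Data.Vec using (Vec; zipWith; lookup)
open import Data.List using (List; concatMap; map)
open import Data.List.Membership.Propositional using (_∈_)
open import Data.Product using (Σ; _×_; ∃-syntax)
open import Data.Sum using (_⊎_)
open import Data.Empty using (⊥)
open import Relation.Nullary using (¬_)
open import Relation.Binary.PropositionalEquality using (_≡_)

record Graph (n : ℕ) : Set₁ where
  field
    Adj   : Fin n → Fin n → Set
    sym   : ∀ {u v} → Adj u v → Adj v u
    irrefl : ∀ {v} → ¬ Adj v v
open Graph public

-- A monomial in the variables V(G) = Fin n: a finite multiset of variables,
-- given by its multiplicity vector.
Monomial : ℕ → Set
Monomial n = Vec ℕ n

-- Tropical multiplication of monomials = multiset union.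
_⊗_ : ∀ {n} → Monomial n → Monomial n → Monomial n
a ⊗ b = zipWith _+_ a b

-- A tropical polynomial (all coefficients 0) = a finite set of monomials,
-- represented as a list (membership is what matters).
TropPoly : ℕ → Set
TropPoly n = List (Monomial n)

_·_ : ∀ {n} → TropPoly n → TropPoly n → TropPoly n
g · h = concatMap (λ a → map (λ b → a ⊗ b) h) g

Occurs : ∀ {n} → Fin n → Monomial n → Set
Occurs v m = lookup m v ≥ 1

-- m is of the form v₁⋯v_l with {v₁,…,v_l} an independent set of G
-- (distinct vertices: all multiplicities ≤ 1).
IsIndepMonomial : ∀ {n} → Graph n → Monomial n → Set
IsIndepMonomial G m =
  (∀ v → lookup m v ≤ 1) ×
  (∀ u v → Occurs u m → Occurs v m → ¬ Adj G u v)

IsPartialMWIS : ∀ {n} → Graph n → TropPoly n → Set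
IsPartialMWIS G f = ∀ m → m ∈ f → IsIndepMonomial G m

InSup : ∀ {n} → TropPoly n → Fin n → Set
InSup f v = ∃[ m ] (m ∈ f × Occurs v m)

InClosedNbhd : ∀ {n} → Graph n → (Fin n → Set) → Fin n → Set
InClosedNbhd G S v = S v ⊎ (∃[ u ] (S u × Adj G u v))

-- If a ∈ g and b ∈ h, the product a·b is a monomial of f = g·h, so it is
-- squarefree and its support is independent.  A vertex v in Sup(h) occurs in
-- some b; if v also occurs in some a of g then v has multiplicity ≥ 2 in a·b,
-- and if a neighbour u of v occurs in a then u and v are adjacent in a·b.
module Submission where

open import Defs hiding (sym)
open import Data.Nat using (_+_; _≤_; s≤s)
open import Data.Nat.Properties using (≤-trans; +-mono-≤; m≤m+n; m≤n+m)
open import Data.Fin using (Fin)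
open import Data.Empty using (⊥)
open import Data.Product using (_,_)
open import Data.Sum using (inj₁; inj₂)
open import Data.List using ([]; _∷_; map; _++_; cartesianProductWith)
open import Data.List.Membership.Propositional using (_∈_)
open import Data.List.Membership.Propositional.Properties using (∈-cartesianProductWith⁺)
open import Data.Vec using (lookup)
open import Data.Vec.Properties using (lookup-zipWith)
open import Relation.Nullary using (¬_)
open import Relation.Binary.PropositionalEquality using (_≡_; refl; sym; cong; subst)

·≡cartesianProductWith : ∀ {n} (g h : TropPoly n) → g · h ≡ cartesianProductWith _⊗_ g h
·≡cartesianProductWith []      h = refl
·≡cartesianProductWith (a ∷ g) h = cong (map (a ⊗_) h ++_) (·≡cartesianProductWith g h)

∈-·⁺ : ∀ {n} {g h : TropPoly n} {a b} → a ∈ g → b ∈ h → a ⊗ b ∈ g · h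
∈-·⁺ {g = g} {h} a∈g b∈h =
  subst (_ ∈_) (sym (·≡cartesianProductWith g h)) (∈-cartesianProductWith⁺ _⊗_ a∈g b∈h)

lookup-⊗ : ∀ {n} (a b : Monomial n) v → lookup (a ⊗ b) v ≡ lookup a v + lookup b v
lookup-⊗ a b v = lookup-zipWith _+_ v a b

Occurs-⊗ˡ : ∀ {n} (a b : Monomial n) {v} → Occurs v a → Occurs v (a ⊗ b)
Occurs-⊗ˡ a b {v} o = subst (1 ≤_) (sym (lookup-⊗ a b v)) (≤-trans o (m≤m+n _ _))

Occurs-⊗ʳ : ∀ {n} (a b : Monomial n) {v} → Occurs v b → Occurs v (a ⊗ b)
Occurs-⊗ʳ a b {v} o = subst (1 ≤_) (sym (lookup-⊗ a b v)) (≤-trans o (m≤n+m _ _))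

¬Occurs-both-of-squarefree-⊗ : ∀ {n} (a b : Monomial n) {v} →
                               lookup (a ⊗ b) v ≤ 1 → Occurs v a → ¬ Occurs v b
¬Occurs-both-of-squarefree-⊗ a b {v} sqfree oa ob
  with ≤-trans (+-mono-≤ oa ob) (subst (_≤ 1) (lookup-⊗ a b v) sqfree)
... | s≤s ()

lemma10 : ∀ {n} (G : Graph n) (g h : TropPoly n) →
          IsPartialMWIS G (g · h) →
          ∀ (v : Fin n) → InClosedNbhd G (InSup g) v → InSup h v → ⊥
lemma10 G g h mwis v (inj₁ (a , a∈g , va)) (b , b∈h , vb) =
  let (squarefree , _) = mwis (a ⊗ b) (∈-·⁺ a∈g b∈h)
  in ¬Occurs-both-of-squarefree-⊗ a b (squarefree v) va vb
lemma10 G g h mwis v (inj₂ (u , (a , a∈g , ua) , u~v)) (b , b∈h , vb) =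
  let (_ , independent) = mwis (a ⊗ b) (∈-·⁺ a∈g b∈h)
  in independent u v (Occurs-⊗ˡ a b ua) (Occurs-⊗ʳ a b vb) u~v
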